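{- Let $M$ be a matroid, let $S,T$ be disjoint subsets of $E(M)$, let $k := \kappa_M(S,T)$, and let $A_1\subseteq A_2\subseteq\cdots\subseteq A_t$ be a nested sequence of subsets of $E(M)$, each $S$-$T$-separating of order $k+1$; write $B_j := E(M)-A_j$. Let $(C,D)$ be a partition of $E(M)- (S\cup T)$ such that $C$ is independent, $D$ is coindependent, and $\lambda_{M/C\setminus D}(S) = k$. Let $i, j \in \{1, \ldots, t\}$ with $i < j$, let $C' := C \cap (A_j- A_i)$, $D' := D\cap (A_j- A_i)$, and $M' := M/C'\setminus D'$. Then $(A_i, B_j)$ is a partition of $E(M')$ that is $S$-$T$-separating of order $k+1$ in $M'$ (i.e. $\lambda_{M'}(A_i)=k$). Moreover, $M'|A_i = M|A_i$ and $M'|B_j = M|B_j$.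
   Context: For a matroid $M$ with ground set $E$, $\lambda_M(X) := r_M(X) + r_M(E- X) - r(M)$, and for disjoint $S,T\subseteq E$, $\kappa_M(S,T) := \min\{\lambda_M(X) : S \subseteq X \subseteq E- T\}$. A set $A$ (resp. partition $(A,B)$) is $S$-$T$-separating of order $k+1$ if $S\subseteq A$, $T$ is contained in the complement $B$, and $\lambda(A)=k$. -}

module Defs where

open import Data.Nat using (ℕ; _+_; _∸_; _≤_)
open import Data.Fin using (Fin)
open import Data.Fin.Subset using (Subset; _⊆_; _∪_; _∩_; _─_; ∁; ⊥; ∣_∣)
open import Data.Product using (Σ; _×_; ∃-syntax)
open import Relation.Binary.PropositionalEquality using (_≡_)

-- Only the values of r on subsets of E
-- are meaningful.  Minors of matroids are described in this form.
record RankedSet (n : ℕ) : Set where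
  constructor ⟨_,_⟩
  field
    E : Subset n
    r : Subset n → ℕ
open RankedSet public

record Matroid (n : ℕ) : Set where
  field
    ground : Subset n
    rank   : Subset n → ℕ
    rank-bounded    : ∀ X → X ⊆ ground → rank X ≤ ∣ X ∣
    rank-monotone   : ∀ X Y → X ⊆ Y → Y ⊆ ground → rank X ≤ rank Y
    rank-submodular : ∀ X Y → X ⊆ ground → Y ⊆ ground →
                      rank (X ∪ Y) + rank (X ∩ Y) ≤ rank X + rank Y
open Matroid public

⌊_⌋ : ∀ {n} → Matroid n → RankedSet n
⌊ M ⌋ = ⟨ ground M , rank M ⟩

module _ {n : ℕ} where

  _／_ : RankedSet n → Subset n → RankedSet n
  M ／ C = ⟨ E M ─ C , (λ X → r M (X ∪ C) ∸ r M C) ⟩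

  _＼_ : RankedSet n → Subset n → RankedSet n
  M ＼ D = ⟨ E M ─ D , r M ⟩

  _∣ʳ_ : RankedSet n → Subset n → RankedSet n
  M ∣ʳ A = ⟨ A , r M ⟩

  _≅_ : RankedSet n → RankedSet n → Set
  M ≅ N = (E M ≡ E N) × (∀ X → X ⊆ E M → r M X ≡ r N X)

  conn : RankedSet n → Subset n → ℕ
  conn M X = r M X + r M (E M ─ X) ∸ r M (E M)

  Independent : RankedSet n → Subset n → Set
  Independent M X = X ⊆ E M × r M X ≡ ∣ X ∣

  dualRank : RankedSet n → Subset n → ℕ
  dualRank M X = ∣ X ∣ + r M (E M ─ X) ∸ r M (E M)

  Coindependent : RankedSet n → Subset n → Set
  Coindependent M X = X ⊆ E M × dualRank M X ≡ ∣ X ∣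

  IsKappa : RankedSet n → Subset n → Subset n → ℕ → Set
  IsKappa M S T k =
    (∃[ X ] (S ⊆ X × X ⊆ E M ─ T × conn M X ≡ k)) ×
    (∀ X → S ⊆ X → X ⊆ E M ─ T → k ≤ conn M X)

  STSeparating : RankedSet n → Subset n → Subset n → Subset n → ℕ → Set
  STSeparating M S T A k =
    A ⊆ E M × S ⊆ A × T ⊆ E M ─ A × conn M A ≡ k

  IsPartition : Subset n → Subset n → Subset n → Set
  IsPartition P Q X = (P ∩ Q ≡ ⊥) × (P ∪ Q ≡ X)

module Submission where

-- Contracting the rest of C and
-- deleting the rest of D turns M' into M/C\D and Aᵢ into S, and connectivity does not grow
-- under taking minors, so k = λ_{M/C\D}(S) ≤ λ_{M'}(Aᵢ). Conversely, for X disjoint from C'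
-- the identity λ_{M/C'}(X) = λ_M(X) − ⊓(X, C') holds, and deletion does not increase λ;
-- hence λ_{M'}(Aᵢ) + ⊓(Aᵢ, C') ≤ λ_M(Aᵢ) = k, and likewise for Bⱼ, the complement of Aᵢ
-- in M'. So λ_{M'}(Aᵢ) = k and C' is skew to both Aᵢ and Bⱼ, which means that contracting
-- C' leaves the rank of every subset of Aᵢ or of Bⱼ unchanged.

open import Defs
open import Data.Bool using (Bool; true; false; _∧_; _∨_; not; T)
open import Data.Bool.Properties using (T-∧; T-≡)
open import Data.Fin using (Fin; zero; suc; #_) renaming (_<_ to _<ᶠ_; _≤_ to _≤ᶠ_)
open import Data.Fin.Subset using (Subset; _⊆_; _∪_; _∩_; _─_; ⊥; _∈_; ∣_∣)
open import Data.Fin.Subset.Properties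
  using (⊆-refl; ⊆-trans; ⊆-reflexive; ⊆-antisym; ⊥⊆; p─q⊆p; p∩q⊆p; p⊆p∪q; q⊆p∪q; x∈p∪q⁻; ∪-assoc)
open import Data.List using (List; []; _∷_)
open import Data.List.Relation.Unary.All using (All; []; _∷_)
open import Data.Nat using (ℕ; zero; suc; _+_; _∸_; _≤_)
open import Data.Nat.Properties
open import Algebra.Properties.CommutativeSemigroup +-commutativeSemigroup
  using (interchange; x∙yz≈xz∙y; x∙yz≈yx∙z; xy∙z≈y∙zx; xy∙z≈xz∙y; xy∙z≈y∙xz; xy∙z≈x∙zy)
open import Data.Product using (_×_; _,_; proj₁; proj₂)
open import Data.Sum using ([_,_]′)
open import Data.Unit using (tt)
open import Data.Vec using (Vec; []; _∷_; lookup; map)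
open import Data.Vec.Properties
  using (lookup-map; lookup-zipWith; lookup-replicate; []=⇒lookup; lookup⇒[]=)
open import Function using (Equivalence)
open import Relation.Binary.PropositionalEquality
  using (_≡_; refl; sym; trans; cong; cong₂; module ≡-Reasoning)

-- Inclusions between Boolean combinations of subsets, under inclusion premises, are decided
-- pointwise: the memberships of a single element in the m atoms form a Boolean valuation,
-- so it suffices to check all 2^m valuations.
module SubsetExpr where

  infixr 9 _∩ₑ_
  infixr 8 _∪ₑ_
  infixl 7 _─ₑ_
  infix  6 _⊆ₑ_

  data Expr (m : ℕ) : Set where
    var            : Fin m → Expr m
    ∅ₑ             : Expr m
    _∪ₑ_ _∩ₑ_ _─ₑ_ : Expr m → Expr m → Expr m

  ⟦_⟧ : ∀ {m n} → Expr m → Vec (Subset n) m → Subset n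
  ⟦ var i    ⟧ ρ = lookup ρ i
  ⟦ ∅ₑ       ⟧ ρ = ⊥
  ⟦ e₁ ∪ₑ e₂ ⟧ ρ = ⟦ e₁ ⟧ ρ ∪ ⟦ e₂ ⟧ ρ
  ⟦ e₁ ∩ₑ e₂ ⟧ ρ = ⟦ e₁ ⟧ ρ ∩ ⟦ e₂ ⟧ ρ
  ⟦ e₁ ─ₑ e₂ ⟧ ρ = ⟦ e₁ ⟧ ρ ─ ⟦ e₂ ⟧ ρ

  ⟦_⟧ᵇ : ∀ {m} → Expr m → Vec Bool m → Bool
  ⟦ var i    ⟧ᵇ v = lookup v i
  ⟦ ∅ₑ       ⟧ᵇ v = false
  ⟦ e₁ ∪ₑ e₂ ⟧ᵇ v = ⟦ e₁ ⟧ᵇ v ∨ ⟦ e₂ ⟧ᵇ v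
  ⟦ e₁ ∩ₑ e₂ ⟧ᵇ v = ⟦ e₁ ⟧ᵇ v ∧ ⟦ e₂ ⟧ᵇ v
  ⟦ e₁ ─ₑ e₂ ⟧ᵇ v = ⟦ e₁ ⟧ᵇ v ∧ not (⟦ e₂ ⟧ᵇ v)

  record Inclusion (m : ℕ) : Set where
    constructor _⊆ₑ_
    field
      lhs rhs : Expr m

  Holds : ∀ {m n} → Vec (Subset n) m → Inclusion m → Set
  Holds ρ (e₁ ⊆ₑ e₂) = ⟦ e₁ ⟧ ρ ⊆ ⟦ e₂ ⟧ ρ

  _⇒ᵇ_ : Bool → Bool → Bool
  true  ⇒ᵇ b = b
  false ⇒ᵇ _ = true

  holdsᵇ : ∀ {m} → Vec Bool m → Inclusion m → Bool
  holdsᵇ v (e₁ ⊆ₑ e₂) = ⟦ e₁ ⟧ᵇ v ⇒ᵇ ⟦ e₂ ⟧ᵇ v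

  allHoldᵇ : ∀ {m} → Vec Bool m → List (Inclusion m) → Bool
  allHoldᵇ v []       = true
  allHoldᵇ v (h ∷ hs) = holdsᵇ v h ∧ allHoldᵇ v hs

  forallᵇ : ∀ m → (Vec Bool m → Bool) → Bool
  forallᵇ zero    P = P []
  forallᵇ (suc m) P = forallᵇ m (λ v → P (true ∷ v)) ∧ forallᵇ m (λ v → P (false ∷ v))

  Entails : ∀ {m} → List (Inclusion m) → Inclusion m → Set
  Entails hs g = T (forallᵇ _ λ v → allHoldᵇ v hs ⇒ᵇ holdsᵇ v g)

  forallᵇ-sound : ∀ m P → T (forallᵇ m P) → ∀ v → T (P v)
  forallᵇ-sound zero    P t []          = t
  forallᵇ-sound (suc m) P t (true ∷ v)  = forallᵇ-sound m _ (proj₁ (Equivalence.to T-∧ t)) v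
  forallᵇ-sound (suc m) P t (false ∷ v) = forallᵇ-sound m _ (proj₂ (Equivalence.to T-∧ t)) v

  ⇒ᵇ-elim : ∀ {a b} → T (a ⇒ᵇ b) → T a → T b
  ⇒ᵇ-elim {true} t _ = t

  ⇒ᵇ-intro : ∀ {a b} → (T a → T b) → T (a ⇒ᵇ b)
  ⇒ᵇ-intro {true}  f = f tt
  ⇒ᵇ-intro {false} _ = tt

  valuationAt : ∀ {m n} → Vec (Subset n) m → Fin n → Vec Bool m
  valuationAt ρ x = map (λ p → lookup p x) ρ

  lookup-─ : ∀ {n} (p q : Subset n) x → lookup (p ─ q) x ≡ lookup p x ∧ not (lookup q x)
  lookup-─ (true  ∷ _) (true  ∷ _) zero    = refl
  lookup-─ (true  ∷ _) (false ∷ _) zero    = refl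
  lookup-─ (false ∷ _) (true  ∷ _) zero    = refl
  lookup-─ (false ∷ _) (false ∷ _) zero    = refl
  lookup-─ (_     ∷ p) (_     ∷ q) (suc x) = lookup-─ p q x

  lookup-⟦⟧ : ∀ {m n} (e : Expr m) (ρ : Vec (Subset n) m) x →
              lookup (⟦ e ⟧ ρ) x ≡ ⟦ e ⟧ᵇ (valuationAt ρ x)
  lookup-⟦⟧ (var i)    ρ x = sym (lookup-map i (λ p → lookup p x) ρ)
  lookup-⟦⟧ ∅ₑ         ρ x = lookup-replicate x false
  lookup-⟦⟧ (e₁ ∪ₑ e₂) ρ x = trans (lookup-zipWith _∨_ x (⟦ e₁ ⟧ ρ) (⟦ e₂ ⟧ ρ))
                                   (cong₂ _∨_ (lookup-⟦⟧ e₁ ρ x) (lookup-⟦⟧ e₂ ρ x))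
  lookup-⟦⟧ (e₁ ∩ₑ e₂) ρ x = trans (lookup-zipWith _∧_ x (⟦ e₁ ⟧ ρ) (⟦ e₂ ⟧ ρ))
                                   (cong₂ _∧_ (lookup-⟦⟧ e₁ ρ x) (lookup-⟦⟧ e₂ ρ x))
  lookup-⟦⟧ (e₁ ─ₑ e₂) ρ x = trans (lookup-─ (⟦ e₁ ⟧ ρ) (⟦ e₂ ⟧ ρ) x)
                                   (cong₂ (λ a b → a ∧ not b) (lookup-⟦⟧ e₁ ρ x) (lookup-⟦⟧ e₂ ρ x))

  module _ {m n} (ρ : Vec (Subset n) m) where

    ∈⇒T : ∀ e {x} → x ∈ ⟦ e ⟧ ρ → T (⟦ e ⟧ᵇ (valuationAt ρ x))
    ∈⇒T e {x} x∈ = Equivalence.from T-≡ (trans (sym (lookup-⟦⟧ e ρ x)) ([]=⇒lookup x∈))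

    T⇒∈ : ∀ e {x} → T (⟦ e ⟧ᵇ (valuationAt ρ x)) → x ∈ ⟦ e ⟧ ρ
    T⇒∈ e {x} t = lookup⇒[]= x (⟦ e ⟧ ρ) (trans (lookup-⟦⟧ e ρ x) (Equivalence.to T-≡ t))

    holds⇒T : ∀ h {x} → Holds ρ h → T (holdsᵇ (valuationAt ρ x) h)
    holds⇒T (e₁ ⊆ₑ e₂) e₁⊆e₂ = ⇒ᵇ-intro (λ t → ∈⇒T e₂ (e₁⊆e₂ (T⇒∈ e₁ t)))

    allHold⇒T : ∀ {hs x} → All (Holds ρ) hs → T (allHoldᵇ (valuationAt ρ x) hs)
    allHold⇒T []                 = tt
    allHold⇒T {h ∷ _} (p ∷ ps) = Equivalence.from T-∧ (holds⇒T h p , allHold⇒T ps)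

    entails-sound : ∀ hs g → Entails hs g → All (Holds ρ) hs → Holds ρ g
    entails-sound hs (e₁ ⊆ₑ e₂) ent ps {x} x∈ =
      T⇒∈ e₂ (⇒ᵇ-elim (⇒ᵇ-elim (forallᵇ-sound m _ ent (valuationAt ρ x)) (allHold⇒T ps)) (∈⇒T e₁ x∈))

    ⊆-by-cases : ∀ hs e₁ e₂ → {Entails hs (e₁ ⊆ₑ e₂)} → All (Holds ρ) hs → ⟦ e₁ ⟧ ρ ⊆ ⟦ e₂ ⟧ ρ
    ⊆-by-cases hs e₁ e₂ {ent} = entails-sound hs (e₁ ⊆ₑ e₂) ent

    ≡-by-cases : ∀ hs e₁ e₂ → {Entails hs (e₁ ⊆ₑ e₂)} → {Entails hs (e₂ ⊆ₑ e₁)} →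
                 All (Holds ρ) hs → ⟦ e₁ ⟧ ρ ≡ ⟦ e₂ ⟧ ρ
    ≡-by-cases hs e₁ e₂ {ent₁} {ent₂} ps =
      ⊆-antisym (entails-sound hs (e₁ ⊆ₑ e₂) ent₁ ps) (entails-sound hs (e₂ ⊆ₑ e₁) ent₂ ps)

  𝒙 : ∀ {m} → Expr (suc m)
  𝒙 = var zero

  𝒚 : ∀ {m} → Expr (suc (suc m))
  𝒚 = var (suc zero)

  𝒛 : ∀ {m} → Expr (suc (suc (suc m)))
  𝒛 = var (suc (suc zero))

open SubsetExpr

module _ {n : ℕ} where

  ∪-lub : ∀ {p q r : Subset n} → p ⊆ r → q ⊆ r → p ∪ q ⊆ r
  ∪-lub {p} {q} p⊆r q⊆r x∈p∪q = [ p⊆r , q⊆r ]′ (x∈p∪q⁻ p q x∈p∪q)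

  ∪-monoˡ-⊆ : ∀ {p q r : Subset n} → p ⊆ q → p ∪ r ⊆ q ∪ r
  ∪-monoˡ-⊆ {q = q} {r} p⊆q = ∪-lub (⊆-trans p⊆q (p⊆p∪q r)) (q⊆p∪q q r)

  ─-monoˡ-⊆ : ∀ {p q r : Subset n} → p ⊆ q → p ─ r ⊆ q ─ r
  ─-monoˡ-⊆ {p} {q} {r} p⊆q = ⊆-by-cases (p ∷ q ∷ r ∷ []) (𝒙 ⊆ₑ 𝒚 ∷ []) (𝒙 ─ₑ 𝒛) (𝒚 ─ₑ 𝒛) (p⊆q ∷ [])

  p⊆q⇒q─[q─p]≡p : ∀ {p q : Subset n} → p ⊆ q → q ─ (q ─ p) ≡ p
  p⊆q⇒q─[q─p]≡p {p} {q} p⊆q = ≡-by-cases (p ∷ q ∷ []) (𝒙 ⊆ₑ 𝒚 ∷ []) (𝒚 ─ₑ (𝒚 ─ₑ 𝒙)) 𝒙 (p⊆q ∷ [])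

[m∸o]∸[n∸o]≡m∸n : ∀ m {n o} → o ≤ n → (m ∸ o) ∸ (n ∸ o) ≡ m ∸ n
[m∸o]∸[n∸o]≡m∸n m {n} {o} o≤n = trans (∸-+-assoc m o (n ∸ o)) (cong (m ∸_) (m+[n∸m]≡n o≤n))

[m∸o]+[n∸o]≤[p∸o]+[q∸o] : ∀ {m n p q o} → o ≤ m → o ≤ n → m + n ≤ p + q →
                          (m ∸ o) + (n ∸ o) ≤ (p ∸ o) + (q ∸ o)
[m∸o]+[n∸o]≤[p∸o]+[q∸o] {m} {n} {p} {q} {o} o≤m o≤n m+n≤p+q = +-cancelˡ-≤ (o + o) _ _ (begin
  (o + o) + ((m ∸ o) + (n ∸ o))   ≡⟨ interchange o o (m ∸ o) (n ∸ o) ⟩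
  (o + (m ∸ o)) + (o + (n ∸ o))   ≡⟨ cong₂ _+_ (m+[n∸m]≡n o≤m) (m+[n∸m]≡n o≤n) ⟩
  m + n                           ≤⟨ m+n≤p+q ⟩
  p + q                           ≤⟨ +-mono-≤ (m≤n+m∸n p o) (m≤n+m∸n q o) ⟩
  (o + (p ∸ o)) + (o + (q ∸ o))   ≡⟨ interchange o (p ∸ o) o (q ∸ o) ⟩
  (o + o) + ((p ∸ o) + (q ∸ o))   ∎)
  where open ≤-Reasoning

≤-+-squeeze : ∀ {m n o} → m ≤ n → n + o ≤ m → n ≡ m × o ≡ 0
≤-+-squeeze {m} {n} {o} m≤n n+o≤m =
  ≤-antisym (≤-trans (m≤m+n n o) n+o≤m) m≤n ,
  n≤0⇒n≡0 (+-cancelˡ-≤ n o 0 (≤-trans n+o≤m (≤-trans m≤n (≤-reflexive (sym (+-identityʳ n))))))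

localConn : ∀ {n} → Matroid n → Subset n → Subset n → ℕ
localConn M X Y = rank M X + rank M Y ∸ rank M (X ∪ Y)

module _ {n : ℕ} (M : Matroid n) where

  rank-submodular-⊆ : ∀ {X Y U I} → X ⊆ ground M → Y ⊆ ground M → U ⊆ X ∪ Y → I ⊆ X ∩ Y →
                      rank M U + rank M I ≤ rank M X + rank M Y
  rank-submodular-⊆ {X} {Y} {U} {I} X⊆E Y⊆E U⊆X∪Y I⊆X∩Y = begin
    rank M U + rank M I
      ≤⟨ +-mono-≤ (rank-monotone M U (X ∪ Y) U⊆X∪Y (∪-lub X⊆E Y⊆E))
                  (rank-monotone M I (X ∩ Y) I⊆X∩Y (⊆-trans (p∩q⊆p X Y) X⊆E)) ⟩
    rank M (X ∪ Y) + rank M (X ∩ Y)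
      ≤⟨ rank-submodular M X Y X⊆E Y⊆E ⟩
    rank M X + rank M Y ∎
    where open ≤-Reasoning

  rank-subadditive-⊆ : ∀ {X Y U} → X ⊆ ground M → Y ⊆ ground M → U ⊆ X ∪ Y →
                       rank M U ≤ rank M X + rank M Y
  rank-subadditive-⊆ X⊆E Y⊆E U⊆X∪Y = ≤-trans (m≤m+n _ _) (rank-submodular-⊆ X⊆E Y⊆E U⊆X∪Y ⊥⊆)

  conn+rank≡ : ∀ {X} → X ⊆ ground M →
               conn ⌊ M ⌋ X + rank M (ground M) ≡ rank M X + rank M (ground M ─ X)
  conn+rank≡ {X} X⊆E = m∸n+n≡m (rank-subadditive-⊆ X⊆E (p─q⊆p _ X) E⊆X∪[E─X])
    where
    E⊆X∪[E─X] : ground M ⊆ X ∪ (ground M ─ X)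
    E⊆X∪[E─X] = ⊆-by-cases (X ∷ ground M ∷ []) (𝒙 ⊆ₑ 𝒚 ∷ []) 𝒚 (𝒙 ∪ₑ (𝒚 ─ₑ 𝒙)) (X⊆E ∷ [])

  localConn+rank≡ : ∀ {X Y} → X ⊆ ground M → Y ⊆ ground M →
                    localConn M X Y + rank M (X ∪ Y) ≡ rank M X + rank M Y
  localConn+rank≡ X⊆E Y⊆E = m∸n+n≡m (rank-subadditive-⊆ X⊆E Y⊆E ⊆-refl)

  localConn-monoˡ : ∀ {X A C} → X ⊆ A → A ⊆ ground M → C ⊆ ground M →
                    localConn M X C ≤ localConn M A C
  localConn-monoˡ {X} {A} {C} X⊆A A⊆E C⊆E = +-cancelʳ-≤ (rA∪C + rX∪C) _ _ (begin
    localConn M X C + (rA∪C + rX∪C)      ≡⟨ x∙yz≈xz∙y (localConn M X C) rA∪C rX∪C ⟩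
    (localConn M X C + rX∪C) + rA∪C      ≡⟨ cong (_+ rA∪C) (localConn+rank≡ X⊆E C⊆E) ⟩
    (rank M X + rank M C) + rA∪C         ≡⟨ xy∙z≈y∙zx (rank M X) (rank M C) rA∪C ⟩
    rank M C + (rA∪C + rank M X)         ≤⟨ +-monoʳ-≤ (rank M C) submodular ⟩
    rank M C + (rank M A + rX∪C)         ≡⟨ x∙yz≈yx∙z (rank M C) (rank M A) rX∪C ⟩
    (rank M A + rank M C) + rX∪C         ≡⟨ cong (_+ rX∪C) (localConn+rank≡ A⊆E C⊆E) ⟨
    (localConn M A C + rA∪C) + rX∪C      ≡⟨ +-assoc (localConn M A C) rA∪C rX∪C ⟩
    localConn M A C + (rA∪C + rX∪C)      ∎)
    where
    open ≤-Reasoning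
    rA∪C = rank M (A ∪ C)
    rX∪C = rank M (X ∪ C)
    X⊆E = ⊆-trans X⊆A A⊆E
    A∪C⊆A∪[X∪C] : A ∪ C ⊆ A ∪ (X ∪ C)
    A∪C⊆A∪[X∪C] = ⊆-by-cases (X ∷ A ∷ C ∷ []) [] (𝒚 ∪ₑ 𝒛) (𝒚 ∪ₑ 𝒙 ∪ₑ 𝒛) []
    X⊆A∩[X∪C] : X ⊆ A ∩ (X ∪ C)
    X⊆A∩[X∪C] = ⊆-by-cases (X ∷ A ∷ C ∷ []) (𝒙 ⊆ₑ 𝒚 ∷ []) 𝒙 (𝒚 ∩ₑ (𝒙 ∪ₑ 𝒛)) (X⊆A ∷ [])
    submodular : rA∪C + rank M X ≤ rank M A + rX∪C
    submodular = rank-submodular-⊆ A⊆E (∪-lub X⊆E C⊆E) A∪C⊆A∪[X∪C] X⊆A∩[X∪C]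

  skew⇒contraction-rank≡ : ∀ {X A C} → A ⊆ ground M → C ⊆ ground M → localConn M A C ≡ 0 →
                           X ⊆ A → rank M (X ∪ C) ∸ rank M C ≡ rank M X
  skew⇒contraction-rank≡ {X} {A} {C} A⊆E C⊆E ⊓AC≡0 X⊆A = begin
    rank M (X ∪ C) ∸ rank M C                        ≡⟨ cong (_∸ rank M C) rank-X∪C ⟩
    (localConn M X C + rank M (X ∪ C)) ∸ rank M C    ≡⟨ cong (_∸ rank M C) (localConn+rank≡ X⊆E C⊆E) ⟩
    rank M X + rank M C ∸ rank M C                   ≡⟨ m+n∸n≡m (rank M X) (rank M C) ⟩
    rank M X ∎
    where
    open ≡-Reasoning
    X⊆E = ⊆-trans X⊆A A⊆E
    ⊓XC≡0 : localConn M X C ≡ 0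
    ⊓XC≡0 = n≤0⇒n≡0 (≤-trans (localConn-monoˡ X⊆A A⊆E C⊆E) (≤-reflexive ⊓AC≡0))
    rank-X∪C : rank M (X ∪ C) ≡ localConn M X C + rank M (X ∪ C)
    rank-X∪C = cong (_+ rank M (X ∪ C)) (sym ⊓XC≡0)

-- ⌊ contraction M C _ ⌋ and ⌊ deletion M D ⌋ are definitionally ⌊ M ⌋ ／ C and ⌊ M ⌋ ＼ D.
contraction : ∀ {n} (M : Matroid n) (C : Subset n) → C ⊆ ground M → Matroid n
contraction M C C⊆E = record
  { ground          = ground M ─ C
  ; rank            = λ X → rank M (X ∪ C) ∸ rank M C
  ; rank-bounded    = λ X X⊆E─C → m≤n+o⇒m∸n≤o (rank M (X ∪ C)) (rank M C) (bounded X⊆E─C)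
  ; rank-monotone   = λ X Y X⊆Y Y⊆E─C →
      ∸-monoˡ-≤ (rank M C) (rank-monotone M (X ∪ C) (Y ∪ C) (∪-monoˡ-⊆ X⊆Y) (∪C⊆E Y⊆E─C))
  ; rank-submodular = λ X Y X⊆E─C Y⊆E─C →
      [m∸o]+[n∸o]≤[p∸o]+[q∸o] (rank-C≤ (∪-lub X⊆E─C Y⊆E─C)) (rank-C≤ (⊆-trans (p∩q⊆p X Y) X⊆E─C))
        (rank-submodular-⊆ M (∪C⊆E X⊆E─C) (∪C⊆E Y⊆E─C) (∪-over-∪C X Y) (∩-over-∪C X Y))
  }
  where
  ∪C⊆E : ∀ {X} → X ⊆ ground M ─ C → X ∪ C ⊆ ground M
  ∪C⊆E X⊆E─C = ∪-lub (⊆-trans X⊆E─C (p─q⊆p _ C)) C⊆E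

  rank-C≤ : ∀ {X} → X ⊆ ground M ─ C → rank M C ≤ rank M (X ∪ C)
  rank-C≤ {X} X⊆E─C = rank-monotone M C (X ∪ C) (q⊆p∪q X C) (∪C⊆E X⊆E─C)

  bounded : ∀ {X} → X ⊆ ground M ─ C → rank M (X ∪ C) ≤ rank M C + ∣ X ∣
  bounded {X} X⊆E─C = begin
    rank M (X ∪ C)       ≤⟨ rank-subadditive-⊆ M X⊆E C⊆E ⊆-refl ⟩
    rank M X + rank M C  ≤⟨ +-monoˡ-≤ (rank M C) (rank-bounded M X X⊆E) ⟩
    ∣ X ∣ + rank M C     ≡⟨ +-comm ∣ X ∣ (rank M C) ⟩
    rank M C + ∣ X ∣     ∎
    where
    open ≤-Reasoning
    X⊆E = ⊆-trans X⊆E─C (p─q⊆p _ C)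

  ∪-over-∪C : ∀ X Y → (X ∪ Y) ∪ C ⊆ (X ∪ C) ∪ (Y ∪ C)
  ∪-over-∪C X Y = ⊆-by-cases (X ∷ Y ∷ C ∷ []) [] ((𝒙 ∪ₑ 𝒚) ∪ₑ 𝒛) ((𝒙 ∪ₑ 𝒛) ∪ₑ (𝒚 ∪ₑ 𝒛)) []

  ∩-over-∪C : ∀ X Y → (X ∩ Y) ∪ C ⊆ (X ∪ C) ∩ (Y ∪ C)
  ∩-over-∪C X Y = ⊆-by-cases (X ∷ Y ∷ C ∷ []) [] ((𝒙 ∩ₑ 𝒚) ∪ₑ 𝒛) ((𝒙 ∪ₑ 𝒛) ∩ₑ (𝒚 ∪ₑ 𝒛)) []

deletion : ∀ {n} → Matroid n → Subset n → Matroid n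
deletion M D = record
  { ground          = ground M ─ D
  ; rank            = rank M
  ; rank-bounded    = λ X X⊆E─D → rank-bounded M X (⊆-trans X⊆E─D (p─q⊆p _ D))
  ; rank-monotone   = λ X Y X⊆Y Y⊆E─D → rank-monotone M X Y X⊆Y (⊆-trans Y⊆E─D (p─q⊆p _ D))
  ; rank-submodular = λ X Y X⊆E─D Y⊆E─D →
      rank-submodular M X Y (⊆-trans X⊆E─D (p─q⊆p _ D)) (⊆-trans Y⊆E─D (p─q⊆p _ D))
  }

module _ {n : ℕ} where

  ≅⇒conn≡ : ∀ {N₁ N₂ : RankedSet n} {X} → N₁ ≅ N₂ → X ⊆ E N₁ → conn N₁ X ≡ conn N₂ X
  ≅⇒conn≡ {N₁} {N₂} {X} (E₁≡E₂ , r₁≡r₂) X⊆E₁ = begin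
    r N₁ X + r N₁ (E N₁ ─ X) ∸ r N₁ (E N₁)
      ≡⟨ cong₂ _∸_ (cong₂ _+_ (r₁≡r₂ X X⊆E₁) (r₁≡r₂ _ (p─q⊆p _ X))) (r₁≡r₂ _ ⊆-refl) ⟩
    r N₂ X + r N₂ (E N₁ ─ X) ∸ r N₂ (E N₁)
      ≡⟨ cong (λ F → r N₂ X + r N₂ (F ─ X) ∸ r N₂ F) E₁≡E₂ ⟩
    conn N₂ X ∎
    where open ≡-Reasoning

  conn-complement : ∀ (N : RankedSet n) {X} → X ⊆ E N → conn N (E N ─ X) ≡ conn N X
  conn-complement N {X} X⊆E = begin
    r N (E N ─ X) + r N (E N ─ (E N ─ X)) ∸ r N (E N)
      ≡⟨ cong (λ Y → r N (E N ─ X) + r N Y ∸ r N (E N)) (p⊆q⇒q─[q─p]≡p X⊆E) ⟩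
    r N (E N ─ X) + r N X ∸ r N (E N)
      ≡⟨ cong (_∸ r N (E N)) (+-comm (r N (E N ─ X)) (r N X)) ⟩
    conn N X ∎
    where open ≡-Reasoning

module _ {n : ℕ} (M : Matroid n) {C : Subset n} (C⊆E : C ⊆ ground M) where

  private
    M／C = contraction M C C⊆E

  contraction-rank+rank≡ : ∀ {X} → X ⊆ ground M ─ C → rank M／C X + rank M C ≡ rank M (X ∪ C)
  contraction-rank+rank≡ {X} X⊆E─C = m∸n+n≡m (rank-monotone M C (X ∪ C) (q⊆p∪q X C) X∪C⊆E)
    where X∪C⊆E = ∪-lub (⊆-trans X⊆E─C (p─q⊆p _ C)) C⊆E

  conn-contraction+ranks : ∀ {Y} → Y ⊆ ground M ─ C →
    conn ⌊ M／C ⌋ Y + (rank M (ground M) + rank M C) ≡ rank M (Y ∪ C) + rank M (ground M ─ Y)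
  conn-contraction+ranks {Y} Y⊆E─C = begin
    conn ⌊ M／C ⌋ Y + (rank M (ground M) + rank M C)
      ≡⟨ cong (λ x → conn ⌊ M／C ⌋ Y + (x + rank M C)) rank-E ⟨
    conn ⌊ M／C ⌋ Y + ((rank M／C E' + rank M C) + rank M C)
      ≡⟨ cong (conn ⌊ M／C ⌋ Y +_) (+-assoc (rank M／C E') (rank M C) (rank M C)) ⟩
    conn ⌊ M／C ⌋ Y + (rank M／C E' + (rank M C + rank M C))
      ≡⟨ +-assoc (conn ⌊ M／C ⌋ Y) (rank M／C E') _ ⟨
    (conn ⌊ M／C ⌋ Y + rank M／C E') + (rank M C + rank M C)
      ≡⟨ cong (_+ (rank M C + rank M C)) (conn+rank≡ M／C Y⊆E─C) ⟩
    (rank M／C Y + rank M／C (E' ─ Y)) + (rank M C + rank M C)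
      ≡⟨ interchange (rank M／C Y) (rank M／C (E' ─ Y)) (rank M C) (rank M C) ⟩
    (rank M／C Y + rank M C) + (rank M／C (E' ─ Y) + rank M C)
      ≡⟨ cong₂ _+_ (contraction-rank+rank≡ Y⊆E─C) (contraction-rank+rank≡ (p─q⊆p E' Y)) ⟩
    rank M (Y ∪ C) + rank M ((E' ─ Y) ∪ C)
      ≡⟨ cong (λ Z → rank M (Y ∪ C) + rank M Z) [E─C─Y]∪C≡E─Y ⟩
    rank M (Y ∪ C) + rank M (ground M ─ Y) ∎
    where
    open ≡-Reasoning
    E' = ground M ─ C
    [E─C]∪C≡E : (ground M ─ C) ∪ C ≡ ground M
    [E─C]∪C≡E = ≡-by-cases (ground M ∷ C ∷ []) (𝒚 ⊆ₑ 𝒙 ∷ []) ((𝒙 ─ₑ 𝒚) ∪ₑ 𝒚) 𝒙 (C⊆E ∷ [])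
    [E─C─Y]∪C≡E─Y : (ground M ─ C ─ Y) ∪ C ≡ ground M ─ Y
    [E─C─Y]∪C≡E─Y = ≡-by-cases (ground M ∷ C ∷ Y ∷ []) (𝒚 ⊆ₑ 𝒙 ∷ 𝒛 ⊆ₑ 𝒙 ─ₑ 𝒚 ∷ [])
                      ((𝒙 ─ₑ 𝒚 ─ₑ 𝒛) ∪ₑ 𝒚) (𝒙 ─ₑ 𝒛) (C⊆E ∷ Y⊆E─C ∷ [])
    rank-E : rank M／C E' + rank M C ≡ rank M (ground M)
    rank-E = trans (contraction-rank+rank≡ ⊆-refl) (cong (rank M) [E─C]∪C≡E)

  conn-contraction+localConn≡ : ∀ {X} → X ⊆ ground M ─ C →
                                conn ⌊ M／C ⌋ X + localConn M X C ≡ conn ⌊ M ⌋ X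
  conn-contraction+localConn≡ {X} X⊆E─C = +-cancelʳ-≡ (rE + rC) _ _ (begin
    (conn ⌊ M／C ⌋ X + localConn M X C) + (rE + rC)
      ≡⟨ xy∙z≈y∙xz (conn ⌊ M／C ⌋ X) (localConn M X C) (rE + rC) ⟩
    localConn M X C + (conn ⌊ M／C ⌋ X + (rE + rC))
      ≡⟨ cong (localConn M X C +_) (conn-contraction+ranks X⊆E─C) ⟩
    localConn M X C + (rank M (X ∪ C) + rank M (ground M ─ X))
      ≡⟨ +-assoc (localConn M X C) (rank M (X ∪ C)) _ ⟨
    (localConn M X C + rank M (X ∪ C)) + rank M (ground M ─ X)
      ≡⟨ cong (_+ rank M (ground M ─ X)) (localConn+rank≡ M X⊆E C⊆E) ⟩
    (rank M X + rC) + rank M (ground M ─ X)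
      ≡⟨ xy∙z≈xz∙y (rank M X) rC _ ⟩
    (rank M X + rank M (ground M ─ X)) + rC
      ≡⟨ cong (_+ rC) (conn+rank≡ M X⊆E) ⟨
    (conn ⌊ M ⌋ X + rE) + rC
      ≡⟨ +-assoc (conn ⌊ M ⌋ X) rE rC ⟩
    conn ⌊ M ⌋ X + (rE + rC) ∎)
    where
    open ≡-Reasoning
    rE = rank M (ground M)
    rC = rank M C
    X⊆E = ⊆-trans X⊆E─C (p─q⊆p _ C)

  conn-contraction-≤ : ∀ {X} → X ⊆ ground M → conn ⌊ M／C ⌋ (X ─ C) ≤ conn ⌊ M ⌋ X
  conn-contraction-≤ {X} X⊆E = +-cancelʳ-≤ (rE + rC) _ _ (begin
    conn ⌊ M／C ⌋ (X ─ C) + (rE + rC)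
      ≡⟨ conn-contraction+ranks (─-monoˡ-⊆ X⊆E) ⟩
    rank M ((X ─ C) ∪ C) + rank M (ground M ─ (X ─ C))
      ≡⟨ cong (λ Z → rank M Z + rank M (ground M ─ (X ─ C))) [X─C]∪C≡X∪C ⟩
    rank M (X ∪ C) + rank M (ground M ─ (X ─ C))
      ≤⟨ +-monoʳ-≤ (rank M (X ∪ C)) (rank-subadditive-⊆ M (p─q⊆p _ X) X∩C⊆E E─[X─C]⊆[E─X]∪[X∩C]) ⟩
    rank M (X ∪ C) + (rank M (ground M ─ X) + rank M (X ∩ C))
      ≡⟨ x∙yz≈xz∙y (rank M (X ∪ C)) (rank M (ground M ─ X)) (rank M (X ∩ C)) ⟩
    (rank M (X ∪ C) + rank M (X ∩ C)) + rank M (ground M ─ X)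
      ≤⟨ +-monoˡ-≤ (rank M (ground M ─ X)) (rank-submodular M X C X⊆E C⊆E) ⟩
    (rank M X + rC) + rank M (ground M ─ X)
      ≡⟨ xy∙z≈xz∙y (rank M X) rC _ ⟩
    (rank M X + rank M (ground M ─ X)) + rC
      ≡⟨ cong (_+ rC) (conn+rank≡ M X⊆E) ⟨
    (conn ⌊ M ⌋ X + rE) + rC
      ≡⟨ +-assoc (conn ⌊ M ⌋ X) rE rC ⟩
    conn ⌊ M ⌋ X + (rE + rC) ∎)
    where
    open ≤-Reasoning
    rE = rank M (ground M)
    rC = rank M C
    X∩C⊆E = ⊆-trans (p∩q⊆p X C) X⊆E
    [X─C]∪C≡X∪C : (X ─ C) ∪ C ≡ X ∪ C
    [X─C]∪C≡X∪C = ≡-by-cases (X ∷ C ∷ []) [] ((𝒙 ─ₑ 𝒚) ∪ₑ 𝒚) (𝒙 ∪ₑ 𝒚) []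
    E─[X─C]⊆[E─X]∪[X∩C] : ground M ─ (X ─ C) ⊆ (ground M ─ X) ∪ (X ∩ C)
    E─[X─C]⊆[E─X]∪[X∩C] = ⊆-by-cases (ground M ∷ X ∷ C ∷ []) (𝒛 ⊆ₑ 𝒙 ∷ [])
                            (𝒙 ─ₑ (𝒚 ─ₑ 𝒛)) ((𝒙 ─ₑ 𝒚) ∪ₑ (𝒚 ∩ₑ 𝒛)) (C⊆E ∷ [])

module _ {n : ℕ} (M : Matroid n) where

  conn-deletion-≤ : ∀ {D X} → X ⊆ ground M → conn ⌊ deletion M D ⌋ (X ─ D) ≤ conn ⌊ M ⌋ X
  conn-deletion-≤ {D} {X} X⊆E = +-cancelʳ-≤ (rF + rE) _ _ (begin
    conn ⌊ deletion M D ⌋ (X ─ D) + (rF + rE)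
      ≡⟨ +-assoc (conn ⌊ deletion M D ⌋ (X ─ D)) rF rE ⟨
    (conn ⌊ deletion M D ⌋ (X ─ D) + rF) + rE
      ≡⟨ cong (_+ rE) (conn+rank≡ (deletion M D) (─-monoˡ-⊆ X⊆E)) ⟩
    (rank M (X ─ D) + rank M (F ─ (X ─ D))) + rE
      ≡⟨ xy∙z≈x∙zy (rank M (X ─ D)) (rank M (F ─ (X ─ D))) rE ⟩
    rank M (X ─ D) + (rE + rank M (F ─ (X ─ D)))
      ≤⟨ +-monoʳ-≤ (rank M (X ─ D)) submodular₂ ⟩
    rank M (X ─ D) + (rank M (X ∪ F) + rank M (ground M ─ X))
      ≡⟨ x∙yz≈yx∙z (rank M (X ─ D)) (rank M (X ∪ F)) (rank M (ground M ─ X)) ⟩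
    (rank M (X ∪ F) + rank M (X ─ D)) + rank M (ground M ─ X)
      ≤⟨ +-monoˡ-≤ (rank M (ground M ─ X)) submodular₁ ⟩
    (rank M X + rF) + rank M (ground M ─ X)
      ≡⟨ xy∙z≈xz∙y (rank M X) rF (rank M (ground M ─ X)) ⟩
    (rank M X + rank M (ground M ─ X)) + rF
      ≡⟨ cong (_+ rF) (conn+rank≡ M X⊆E) ⟨
    (conn ⌊ M ⌋ X + rE) + rF
      ≡⟨ xy∙z≈x∙zy (conn ⌊ M ⌋ X) rE rF ⟩
    conn ⌊ M ⌋ X + (rF + rE) ∎)
    where
    open ≤-Reasoning
    F = ground M ─ D
    rF = rank M F
    rE = rank M (ground M)
    ρ = X ∷ ground M ∷ D ∷ []
    X─D⊆X∩F : X ─ D ⊆ X ∩ F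
    X─D⊆X∩F = ⊆-by-cases ρ (𝒙 ⊆ₑ 𝒚 ∷ []) (𝒙 ─ₑ 𝒛) (𝒙 ∩ₑ (𝒚 ─ₑ 𝒛)) (X⊆E ∷ [])
    E⊆[X∪F]∪[E─X] : ground M ⊆ (X ∪ F) ∪ (ground M ─ X)
    E⊆[X∪F]∪[E─X] = ⊆-by-cases ρ [] 𝒚 ((𝒙 ∪ₑ (𝒚 ─ₑ 𝒛)) ∪ₑ (𝒚 ─ₑ 𝒙)) []
    F─[X─D]⊆[X∪F]∩[E─X] : F ─ (X ─ D) ⊆ (X ∪ F) ∩ (ground M ─ X)
    F─[X─D]⊆[X∪F]∩[E─X] = ⊆-by-cases ρ [] (𝒚 ─ₑ 𝒛 ─ₑ (𝒙 ─ₑ 𝒛)) ((𝒙 ∪ₑ (𝒚 ─ₑ 𝒛)) ∩ₑ (𝒚 ─ₑ 𝒙)) []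
    submodular₁ : rank M (X ∪ F) + rank M (X ─ D) ≤ rank M X + rF
    submodular₁ = rank-submodular-⊆ M X⊆E (p─q⊆p _ D) ⊆-refl X─D⊆X∩F
    submodular₂ : rE + rank M (F ─ (X ─ D)) ≤ rank M (X ∪ F) + rank M (ground M ─ X)
    submodular₂ = rank-submodular-⊆ M (∪-lub X⊆E (p─q⊆p _ D)) (p─q⊆p _ X)
                    E⊆[X∪F]∪[E─X] F─[X─D]⊆[X∪F]∩[E─X]

  rank-contraction-contraction : ∀ {C₁ C₂} → C₁ ⊆ ground M → C₂ ⊆ ground M → ∀ X →
    r ((⌊ M ⌋ ／ C₁) ／ C₂) X ≡ rank M (X ∪ (C₂ ∪ C₁)) ∸ rank M (C₂ ∪ C₁)
  rank-contraction-contraction {C₁} {C₂} C₁⊆E C₂⊆E X = begin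
    (rank M ((X ∪ C₂) ∪ C₁) ∸ rank M C₁) ∸ (rank M (C₂ ∪ C₁) ∸ rank M C₁)
      ≡⟨ [m∸o]∸[n∸o]≡m∸n (rank M ((X ∪ C₂) ∪ C₁))
           (rank-monotone M C₁ (C₂ ∪ C₁) (q⊆p∪q C₂ C₁) (∪-lub C₂⊆E C₁⊆E)) ⟩
    rank M ((X ∪ C₂) ∪ C₁) ∸ rank M (C₂ ∪ C₁)
      ≡⟨ cong (λ Z → rank M Z ∸ rank M (C₂ ∪ C₁)) (∪-assoc X C₂ C₁) ⟩
    rank M (X ∪ (C₂ ∪ C₁)) ∸ rank M (C₂ ∪ C₁) ∎
    where open ≡-Reasoning

module _ {n : ℕ} (M : Matroid n) {C D : Subset n} (C⊆E : C ⊆ ground M) where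

  private
    M／C＼D = deletion (contraction M C C⊆E) D

  conn-minor-≤ : ∀ {X} → X ⊆ ground M → conn ⌊ M／C＼D ⌋ (X ─ C ─ D) ≤ conn ⌊ M ⌋ X
  conn-minor-≤ X⊆E =
    ≤-trans (conn-deletion-≤ (contraction M C C⊆E) (─-monoˡ-⊆ X⊆E)) (conn-contraction-≤ M C⊆E X⊆E)

  conn-minor+localConn-≤ : ∀ {X} → X ⊆ ground M ─ C ─ D →
                           conn ⌊ M／C＼D ⌋ X + localConn M X C ≤ conn ⌊ M ⌋ X
  conn-minor+localConn-≤ {X} X⊆E─C─D = begin
    conn ⌊ M／C＼D ⌋ X + localConn M X C
      ≡⟨ cong (λ Y → conn ⌊ M／C＼D ⌋ Y + localConn M X C) X─D≡X ⟨
    conn ⌊ M／C＼D ⌋ (X ─ D) + localConn M X C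
      ≤⟨ +-monoˡ-≤ (localConn M X C) (conn-deletion-≤ (contraction M C C⊆E) X⊆E─C) ⟩
    conn ⌊ contraction M C C⊆E ⌋ X + localConn M X C
      ≡⟨ conn-contraction+localConn≡ M C⊆E X⊆E─C ⟩
    conn ⌊ M ⌋ X ∎
    where
    open ≤-Reasoning
    X⊆E─C = ⊆-trans X⊆E─C─D (p─q⊆p _ D)
    X─D≡X : X ─ D ≡ X
    X─D≡X = ≡-by-cases (X ∷ (ground M ─ C) ∷ D ∷ []) (𝒙 ⊆ₑ 𝒚 ─ₑ 𝒛 ∷ []) (𝒙 ─ₑ 𝒛) 𝒙 (X⊆E─C─D ∷ [])


module NestedSeparations {n : ℕ} (M : Matroid n) {S T C D Aᵢ Aⱼ : Subset n} {k : ℕ}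
  (Aᵢ⊆Aⱼ : Aᵢ ⊆ Aⱼ)
  (sepᵢ : STSeparating ⌊ M ⌋ S T Aᵢ k) (sepⱼ : STSeparating ⌊ M ⌋ S T Aⱼ k)
  (CD-partition : IsPartition C D (ground M ─ (S ∪ T)))
  (conn-S : conn ((⌊ M ⌋ ／ C) ＼ D) S ≡ k)
  where

  B C' D' : Subset n
  B  = ground M ─ Aⱼ
  C' = C ∩ (Aⱼ ─ Aᵢ)
  D' = D ∩ (Aⱼ ─ Aᵢ)

  private
    ρ : Vec (Subset n) 7
    ρ = ground M ∷ S ∷ T ∷ C ∷ D ∷ Aᵢ ∷ Aⱼ ∷ []

    𝑬 𝑺 𝑻 𝑪 𝑫 𝑨ᵢ 𝑨ⱼ 𝑩 𝑪' 𝑫' 𝑬' : Expr 7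
    𝑬  = var (# 0)
    𝑺  = var (# 1)
    𝑻  = var (# 2)
    𝑪  = var (# 3)
    𝑫  = var (# 4)
    𝑨ᵢ = var (# 5)
    𝑨ⱼ = var (# 6)
    𝑩  = 𝑬 ─ₑ 𝑨ⱼ
    𝑪' = 𝑪 ∩ₑ (𝑨ⱼ ─ₑ 𝑨ᵢ)
    𝑫' = 𝑫 ∩ₑ (𝑨ⱼ ─ₑ 𝑨ᵢ)
    𝑬' = 𝑬 ─ₑ 𝑪' ─ₑ 𝑫'

    premises : List (Inclusion 7)
    premises = 𝑨ᵢ ⊆ₑ 𝑨ⱼ ∷ 𝑨ⱼ ⊆ₑ 𝑬 ∷ 𝑺 ⊆ₑ 𝑨ᵢ ∷ 𝑻 ⊆ₑ 𝑬 ─ₑ 𝑨ⱼ ∷ 𝑪 ∩ₑ 𝑫 ⊆ₑ ∅ₑ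
             ∷ 𝑪 ∪ₑ 𝑫 ⊆ₑ 𝑬 ─ₑ (𝑺 ∪ₑ 𝑻) ∷ 𝑬 ─ₑ (𝑺 ∪ₑ 𝑻) ⊆ₑ 𝑪 ∪ₑ 𝑫 ∷ []

    premises-hold : All (Holds ρ) premises
    premises-hold = Aᵢ⊆Aⱼ ∷ proj₁ sepⱼ ∷ proj₁ (proj₂ sepᵢ) ∷ proj₁ (proj₂ (proj₂ sepⱼ))
                  ∷ ⊆-reflexive (proj₁ CD-partition) ∷ ⊆-reflexive (proj₂ CD-partition)
                  ∷ ⊆-reflexive (sym (proj₂ CD-partition)) ∷ []

    ⊆-by-premises : ∀ e₁ e₂ → {Entails premises (e₁ ⊆ₑ e₂)} → ⟦ e₁ ⟧ ρ ⊆ ⟦ e₂ ⟧ ρ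
    ⊆-by-premises e₁ e₂ {ent} = ⊆-by-cases ρ premises e₁ e₂ {ent} premises-hold

    ≡-by-premises : ∀ e₁ e₂ → {Entails premises (e₁ ⊆ₑ e₂)} → {Entails premises (e₂ ⊆ₑ e₁)} →
                    ⟦ e₁ ⟧ ρ ≡ ⟦ e₂ ⟧ ρ
    ≡-by-premises e₁ e₂ {ent₁} {ent₂} = ≡-by-cases ρ premises e₁ e₂ {ent₁} {ent₂} premises-hold

    Aᵢ⊆E : Aᵢ ⊆ ground M
    Aᵢ⊆E = ⊆-by-premises 𝑨ᵢ 𝑬

    C'⊆E : C' ⊆ ground M
    C'⊆E = ⊆-by-premises 𝑪' 𝑬

  M' : Matroid n
  M' = deletion (contraction M C' C'⊆E) D'

  private
    Aᵢ⊆E' : Aᵢ ⊆ ground M'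
    Aᵢ⊆E' = ⊆-by-premises 𝑨ᵢ 𝑬'

    B⊆E' : B ⊆ ground M'
    B⊆E' = ⊆-by-premises 𝑩 𝑬'

    E'─Aᵢ≡B : ground M' ─ Aᵢ ≡ B
    E'─Aᵢ≡B = ≡-by-premises (𝑬' ─ₑ 𝑨ᵢ) 𝑩

    [C─C']⊆E' : C ─ C' ⊆ ground M'
    [C─C']⊆E' = ⊆-by-premises (𝑪 ─ₑ 𝑪') 𝑬'

    [C─C']⊆E : C ─ C' ⊆ ground M
    [C─C']⊆E = ⊆-by-premises (𝑪 ─ₑ 𝑪') 𝑬

    [C─C']∪C'≡C : (C ─ C') ∪ C' ≡ C
    [C─C']∪C'≡C = ≡-by-premises ((𝑪 ─ₑ 𝑪') ∪ₑ 𝑪') 𝑪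

    E'─[C─C']─[D─D']≡E─C─D : ground M' ─ (C ─ C') ─ (D ─ D') ≡ ground M ─ C ─ D
    E'─[C─C']─[D─D']≡E─C─D = ≡-by-premises (𝑬' ─ₑ (𝑪 ─ₑ 𝑪') ─ₑ (𝑫 ─ₑ 𝑫')) (𝑬 ─ₑ 𝑪 ─ₑ 𝑫)

    S≡Aᵢ─[C─C']─[D─D'] : S ≡ Aᵢ ─ (C ─ C') ─ (D ─ D')
    S≡Aᵢ─[C─C']─[D─D'] = ≡-by-premises 𝑺 (𝑨ᵢ ─ₑ (𝑪 ─ₑ 𝑪') ─ₑ (𝑫 ─ₑ 𝑫'))

    S⊆E'─[C─C']─[D─D'] : S ⊆ ground M' ─ (C ─ C') ─ (D ─ D')
    S⊆E'─[C─C']─[D─D'] = ⊆-by-premises 𝑺 (𝑬' ─ₑ (𝑪 ─ₑ 𝑪') ─ₑ (𝑫 ─ₑ 𝑫'))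

  N : Matroid n
  N = deletion (contraction M' (C ─ C') [C─C']⊆E') (D ─ D')

  N≅M／C＼D : ⌊ N ⌋ ≅ ((⌊ M ⌋ ／ C) ＼ D)
  N≅M／C＼D = E'─[C─C']─[D─D']≡E─C─D , λ X _ →
    trans (rank-contraction-contraction M C'⊆E [C─C']⊆E X)
          (cong (λ Z → rank M (X ∪ Z) ∸ rank M Z) [C─C']∪C'≡C)

  k≤conn-Aᵢ : k ≤ conn ⌊ M' ⌋ Aᵢ
  k≤conn-Aᵢ = begin
    k                                         ≡⟨ conn-S ⟨
    conn ((⌊ M ⌋ ／ C) ＼ D) S                 ≡⟨ ≅⇒conn≡ N≅M／C＼D S⊆E'─[C─C']─[D─D'] ⟨
    conn ⌊ N ⌋ S                              ≡⟨ cong (conn ⌊ N ⌋) S≡Aᵢ─[C─C']─[D─D'] ⟩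
    conn ⌊ N ⌋ (Aᵢ ─ (C ─ C') ─ (D ─ D'))     ≤⟨ conn-minor-≤ M' [C─C']⊆E' Aᵢ⊆E' ⟩
    conn ⌊ M' ⌋ Aᵢ                            ∎
    where open ≤-Reasoning

  conn-Aᵢ≡k×Aᵢ-skew-C' : conn ⌊ M' ⌋ Aᵢ ≡ k × localConn M Aᵢ C' ≡ 0
  conn-Aᵢ≡k×Aᵢ-skew-C' = ≤-+-squeeze k≤conn-Aᵢ (begin
    conn ⌊ M' ⌋ Aᵢ + localConn M Aᵢ C'   ≤⟨ conn-minor+localConn-≤ M C'⊆E Aᵢ⊆E' ⟩
    conn ⌊ M ⌋ Aᵢ                         ≡⟨ proj₂ (proj₂ (proj₂ sepᵢ)) ⟩
    k                                     ∎)
    where open ≤-Reasoning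

  B-skew-C' : localConn M B C' ≡ 0
  B-skew-C' = proj₂ (≤-+-squeeze (≤-reflexive (sym conn-B≡k)) (begin
    conn ⌊ M' ⌋ B + localConn M B C'      ≤⟨ conn-minor+localConn-≤ M C'⊆E B⊆E' ⟩
    conn ⌊ M ⌋ B                          ≡⟨ conn-complement ⌊ M ⌋ (proj₁ sepⱼ) ⟩
    conn ⌊ M ⌋ Aⱼ                         ≡⟨ proj₂ (proj₂ (proj₂ sepⱼ)) ⟩
    k                                     ∎))
    where
    open ≤-Reasoning
    conn-B≡k : conn ⌊ M' ⌋ B ≡ k
    conn-B≡k = begin-equality
      conn ⌊ M' ⌋ B                ≡⟨ cong (conn ⌊ M' ⌋) E'─Aᵢ≡B ⟨
      conn ⌊ M' ⌋ (ground M' ─ Aᵢ)  ≡⟨ conn-complement ⌊ M' ⌋ Aᵢ⊆E' ⟩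
      conn ⌊ M' ⌋ Aᵢ                ≡⟨ proj₁ conn-Aᵢ≡k×Aᵢ-skew-C' ⟩
      k                            ∎

  restriction-unchanged : ∀ {A} → A ⊆ ground M → localConn M A C' ≡ 0 → (⌊ M' ⌋ ∣ʳ A) ≅ (⌊ M ⌋ ∣ʳ A)
  restriction-unchanged A⊆E A-skew-C' = refl , λ X X⊆A → skew⇒contraction-rank≡ M A⊆E C'⊆E A-skew-C' X⊆A

  result : IsPartition Aᵢ B (ground M') × STSeparating ⌊ M' ⌋ S T Aᵢ k
           × ((⌊ M' ⌋ ∣ʳ Aᵢ) ≅ (⌊ M ⌋ ∣ʳ Aᵢ)) × ((⌊ M' ⌋ ∣ʳ B) ≅ (⌊ M ⌋ ∣ʳ B))
  result = (≡-by-premises (𝑨ᵢ ∩ₑ 𝑩) ∅ₑ , ≡-by-premises (𝑨ᵢ ∪ₑ 𝑩) 𝑬')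
         , (Aᵢ⊆E' , proj₁ (proj₂ sepᵢ) , ⊆-by-premises 𝑻 (𝑬' ─ₑ 𝑨ᵢ) , proj₁ conn-Aᵢ≡k×Aᵢ-skew-C')
         , restriction-unchanged Aᵢ⊆E (proj₂ conn-Aᵢ≡k×Aᵢ-skew-C')
         , restriction-unchanged (p─q⊆p _ Aⱼ) B-skew-C'

lemma3p7 : {n : ℕ} (M : Matroid n) (S T : Subset n) (k : ℕ) (t : ℕ)
    (A : Fin t → Subset n) (C D : Subset n) →
    S ⊆ ground M → T ⊆ ground M → S ∩ T ≡ ⊥ →
    IsKappa ⌊ M ⌋ S T k →
    (∀ i j → i ≤ᶠ j → A i ⊆ A j) →
    (∀ i → STSeparating ⌊ M ⌋ S T (A i) k) →
    IsPartition C D (ground M ─ (S ∪ T)) →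
    Independent ⌊ M ⌋ C → Coindependent ⌊ M ⌋ D →
    conn ((⌊ M ⌋ ／ C) ＼ D) S ≡ k →
    (i j : Fin t) → i <ᶠ j →
    let B  = ground M ─ A j
        C' = C ∩ (A j ─ A i)
        D' = D ∩ (A j ─ A i)
        M' = (⌊ M ⌋ ／ C') ＼ D'
    in IsPartition (A i) B (E M') × STSeparating M' S T (A i) k
       × ((M' ∣ʳ A i) ≅ (⌊ M ⌋ ∣ʳ A i)) × ((M' ∣ʳ B) ≅ (⌊ M ⌋ ∣ʳ B))
lemma3p7 M S T k t A C D _ _ _ _ nested separating CD-partition _ _ conn-S i j i<j =
  NestedSeparations.result M (nested i j (<⇒≤ i<j)) (separating i) (separating j) CD-partition conn-S
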